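{- Consider the algorithm PCAlg described in the context, run on input $U$, $k$, $\mathcal{S}=\{S_1,\dots,S_m\}$ (having passed step (1)). Then at termination, for all $0\le i\le m$, $1\le j\le k$ and $0\le\ell\le k$, the entry $\mathrm{M}[i,j,\ell]$ represents the family $$Sol_{i,j,\ell}=\Big\{S\subseteq \bigcup\mathcal{S}' : \mathcal{S}'\subseteq\{S_1,\dots,S_i\},\ |S|=j,\ |\mathcal{S}'|=\ell\Big\}.$$
   Context: Representation: for a universe $U$, integer $k$, and a family $\mathcal{F}$ of $p$-subsets of $U$ ($p\le k$), a family $\widehat{\mathcal{F}}$ represents $\mathcal{F}$ if $\widehat{\mathcal{F}}\subseteq\mathcal{F}$ and for every $X\in\mathcal{F}$ and $Y\subseteq U\setminus X$ with $|Y|\le k-p$ there is $\widehat{X}\in\widehat{\mathcal{F}}$ with $\widehat{X}\cap Y=\emptyset$. RepAlg$(U,k,\mathcal{F})$ denotes a procedure that, given a family $\mathcal{F}$ of $p$-subsets of $U$, returns a family that represents $\mathcal{F}$. Algorithm PCAlg$(U,k,\mathcal{S}=\{S_1,\dots,S_m\})$: (1) if some $S\in\mathcal{S}$ has $|S|\ge k$, return 1. (2) Let M be a matrix with an entry $\mathrm{M}[i,j,\ell]$ for all $0\le i\le m$, $1\le j\le k$, $0\le \ell\le k$, each initialized to $\emptyset$. (3) For $i=1,\dots,m$, for $j=1,\dots,k$, for $\ell=1,\dots,\min\{i,k\}$ (nested loops in this order): let $S_i=\{s_1,\dots,s_r\}$; set $\mathcal{A}_{0,0}=\{\emptyset\}$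 and $\mathcal{A}_{0,j'}=\mathrm{M}[i-1,j',\ell-1]$ for $j'=1,\dots,j$; then for $r'=1,\dots,r$ and $j'=0,\dots,j$ set $\mathcal{A}_{r',j'}=$ RepAlg$\big(U,k,\mathcal{A}_{r'-1,j'}\cup\{S\cup\{s_{r'}\}: j'\ge 1,\ S\in\mathcal{A}_{r'-1,j'-1},\ s_{r'}\notin S\}\big)$; finally set $\mathrm{M}[i,j,\ell]=$ RepAlg$(U,k,\mathrm{M}[i-1,j,\ell]\cup\mathcal{A}_{r,j})$. (4) Return the smallest $\ell$ such that $\mathrm{M}[m,k,\ell]\ne\emptyset$. -}

module Defs where

open import Data.Nat using (ℕ; zero; suc; _∸_; _≤_; _<_; _≤ᵇ_; _<?_; _⊓_)
open import Data.Bool using (Bool; true; false; if_then_else_; _∧_)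
open import Data.Fin using (Fin; toℕ; fromℕ<)
open import Data.Fin.Subset using (Subset; _∈_; _∉_; _⊆_; _∩_; _∪_; ∣_∣; ⁅_⁆)
  renaming (⊥ to ∅ˢ)
open import Data.Fin.Subset.Properties using (_∈?_)
open import Data.List using (List; []; _∷_; _++_; map; filter; foldl; allFin)
open import Data.List.Membership.Propositional using () renaming (_∈_ to _∈L_)
open import Data.Product using (Σ; ∃; _×_; _,_)
open import Relation.Nullary using (Dec; yes; no; ¬_)
open import Relation.Nullary.Decidable using (¬?)
open import Relation.Binary.PropositionalEquality using (_≡_)

-- The universe U is Fin n; subsets of U are Data.Fin.Subset n.
-- A family of subsets is either a predicate (Subset n → Set) or,
-- for families manipulated by the algorithm, a List (Subset n).

Disjoint : ∀ {n} → Subset n → Subset n → Set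
Disjoint X Y = X ∩ Y ≡ ∅ˢ

Represents : ∀ {n} (k p : ℕ) → List (Subset n) → (Subset n → Set) → Set
Represents {n} k p F̂ F =
  (∀ X → X ∈L F̂ → F X) ×
  (∀ X → F X → ∀ (Y : Subset n) → Disjoint X Y → ∣ Y ∣ ≤ k ∸ p →
     ∃ λ X̂ → X̂ ∈L F̂ × Disjoint X̂ Y)

IsRepAlg : ∀ {n} (k : ℕ) → (List (Subset n) → List (Subset n)) → Set
IsRepAlg {n} k rep =
  ∀ (p : ℕ) → p ≤ k → (F : List (Subset n)) →
  (∀ X → X ∈L F → ∣ X ∣ ≡ p) →
  Represents k p (rep F) (λ X → X ∈L F)

elements : ∀ {n} → Subset n → List (Fin n)
elements {n} S = filter (λ x → x ∈? S) (allFin n)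

-- S_{i+1} (1-based) as a function of i; out-of-range indices give ∅
-- (never used for 0 ≤ i ≤ m).
getSet : ∀ {n m} → (Fin m → Subset n) → ℕ → Subset n
getSet {m = m} S i with i <? m
... | yes i<m = S (fromℕ< i<m)
... | no _ = ∅ˢ

module PCAlg {n m : ℕ} (rep : List (Subset n) → List (Subset n))
             (k : ℕ) (S : Fin m → Subset n) where

  extend : Fin n → List (Subset n) → List (Subset n)
  extend s 𝒜 = map (λ X → X ∪ ⁅ s ⁆) (filter (λ X → ¬? (s ∈? X)) 𝒜)

  stepA : (ℕ → List (Subset n)) → Fin n → (ℕ → List (Subset n))
  stepA 𝒜 s zero = rep (𝒜 zero)
  stepA 𝒜 s (suc j') = rep (𝒜 (suc j') ++ extend s (𝒜 j'))

  M : ℕ → ℕ → ℕ → List (Subset n)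
  -- 𝒜_{r,·} computed in iteration (i+1, j, ℓ+1) from M[i,·,ℓ]
  Afinal : ℕ → ℕ → (ℕ → List (Subset n))
  Afinal i ℓ = foldl stepA A0 (elements (getSet S i))
    where
      A0 : ℕ → List (Subset n)
      A0 zero = ∅ˢ ∷ []
      A0 (suc j') = M i (suc j') ℓ

  M zero j ℓ = []
  M (suc i) j zero = []
  M (suc i) j (suc ℓ) =
    if (1 ≤ᵇ j) ∧ (j ≤ᵇ k) ∧ (suc ℓ ≤ᵇ (suc i ⊓ k))
    then rep (M i j (suc ℓ) ++ Afinal i ℓ j)
    else []

-- Sol_{i,j,ℓ}: sets S ⊆ ⋃𝒮' with 𝒮' ⊆ {S_1,…,S_i}, |S| = j, |𝒮'| = ℓ.
-- 𝒮' is given by its index set I ⊆ {1,…,i} (Fin m, 0-based: toℕ t < i).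
Sol : ∀ {n m} → (Fin m → Subset n) → ℕ → ℕ → ℕ → Subset n → Set
Sol {n} {m} S i j ℓ X =
  Σ (Subset m) λ I →
    (∀ t → t ∈ I → toℕ t < i) ×
    ∣ I ∣ ≡ ℓ ×
    (∀ x → x ∈ X → ∃ λ t → t ∈ I × x ∈ S t) ×
    ∣ X ∣ ≡ j

module Submission where

-- The entry M[i+1,j,ℓ+1] merges M[i,j,ℓ+1], which represents the
-- solutions not using S_{i+1}, with the output of the inner loop over the elements
-- s₁,…,s_r of S_{i+1}: after s₁,…,s_{r′} have been processed, 𝒜_{r′,j′} represents
-- the j′-sets contained in {s₁,…,s_{r′}} ∪ ⋃𝒮′ for an ℓ-subfamily 𝒮′ of S₁,…,S_i.
-- This invariant survives each step because representation is preserved by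
-- concatenating lists, by applying RepAlg (representation is transitive), and by
-- adding a fixed element s: if 𝒜 represents 𝒢 then {Z ∪ {s} : Z ∈ 𝒜, s ∉ Z}
-- represents {Z ∪ {s} : Z ∈ 𝒢, s ∉ Z}, which is seen by adding s to the set Y to be avoided.

open import Defs
open import Data.Bool using (true; false)
open import Data.Bool.Properties using (T-≡)
open import Data.Fin using (Fin; toℕ; fromℕ<; zero; suc) renaming (_≟_ to _≟ᶠ_)
open import Data.Fin.Properties using (toℕ-injective; toℕ-fromℕ<)
open import Data.Fin.Subset
  using (Subset; _∈_; _∉_; _∪_; _─_; _-_; ∣_∣; ⁅_⁆; inside; outside; Nonempty)
  renaming (⊥ to ∅ˢ)
open import Data.Fin.Subset.Properties
  using ( _∈?_; nonempty?; Empty-unique; ∉⊥; ∣⊥∣≡0; x∈⁅x⁆; x∈⁅y⁆⇒x≡y; ∣⁅x⁆∣≡1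
        ; ⊆-antisym; p⊆q⇒∣p∣≤∣q∣; x∈p∩q⁺; x∈p∩q⁻; x∈p∪q⁺; x∈p∪q⁻; ∪-identityʳ
        ; p─q⊆p; x∈p∧x≢y⇒x∈p-y )
open import Data.List using (List; []; _∷_; [_]; _++_; foldl; allFin)
open import Data.List.Membership.Propositional using () renaming (_∈_ to _∈ˡ_)
open import Data.List.Membership.Propositional.Properties
  using (∈-++⁻; ∈-++⁺ˡ; ∈-++⁺ʳ; ∈-filter⁺; ∈-filter⁻; ∈-map∘filter⁺; ∈-map∘filter⁻; ∈-allFin)
open import Data.List.Relation.Unary.Any using (here; there)
open import Data.Nat using (ℕ; zero; suc; _≤_; _<_; _∸_; _⊓_; _≤ᵇ_; _≤?_; _<?_; z≤n; s≤s)
open import Data.Nat.Properties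
  using ( ≤-reflexive; ≤-trans; <-≤-trans; <-irrefl; ≤-pred; <⇒≤; n≮0; suc-injective
        ; m<n⇒m<1+n; n≤1+n; ≤∧≢⇒<; +-∸-assoc; ⊓-zeroʳ; ⊓-glb; m⊓n≤m; m≤n⇒m⊓n≡m; m≤n⊓o⇒m≤n
        ; ≤ᵇ⇒≤; ≤⇒≤ᵇ )
open import Data.Product using (Σ; ∃; _×_; _,_; proj₁; proj₂; uncurry)
open import Data.Sum using (_⊎_; inj₁; inj₂; [_,_]′) renaming (map₁ to ⊎-map₁)
open import Data.Vec using ([]; _∷_; here; there)
open import Function using (_∘_; id; _⇔_; mk⇔; Equivalence)
open import Relation.Nullary using (¬_; yes; no; contradiction)
open import Relation.Nullary.Decidable using (¬?)
open import Relation.Unary using (_⊆_; _≐_; ∅; ｛_｝) renaming (_∪_ to _∪ᵘ_)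
open import Relation.Binary.PropositionalEquality using (_≡_; _≢_; refl; sym; trans; cong; subst)

private
  variable
    n m k p i j ℓ : ℕ
    s t u x : Fin n
    X Y Z : Subset n
    L L′ : List (Subset n)
    F G : Subset n → Set

x∈p⇒0<∣p∣ : x ∈ X → 0 < ∣ X ∣
x∈p⇒0<∣p∣ {x = x} x∈X =
  <-≤-trans (≤-reflexive (sym (∣⁅x⁆∣≡1 x)))
            (p⊆q⇒∣p∣≤∣q∣ λ y∈⁅x⁆ → subst (_∈ _) (sym (x∈⁅y⁆⇒x≡y x y∈⁅x⁆)) x∈X)

∣p∣≡1+n⇒Nonempty : ∣ X ∣ ≡ suc j → Nonempty X
∣p∣≡1+n⇒Nonempty {n} {X = X} ∣X∣≡1+j with nonempty? X
... | yes ne = ne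
... | no ¬ne with () ← trans (sym ∣X∣≡1+j) (trans (cong ∣_∣ (Empty-unique ¬ne)) (∣⊥∣≡0 n))

∣p∪⁅x⁆∣≡1+∣p∣ : ∀ (p : Subset n) → x ∉ p → ∣ p ∪ ⁅ x ⁆ ∣ ≡ suc ∣ p ∣
∣p∪⁅x⁆∣≡1+∣p∣ {x = zero}  (inside  ∷ p) x∉p = contradiction here x∉p
∣p∪⁅x⁆∣≡1+∣p∣ {x = zero}  (outside ∷ p) _   = cong (suc ∘ ∣_∣) (∪-identityʳ p)
∣p∪⁅x⁆∣≡1+∣p∣ {x = suc x} (inside  ∷ p) x∉p = cong suc (∣p∪⁅x⁆∣≡1+∣p∣ p (x∉p ∘ there))
∣p∪⁅x⁆∣≡1+∣p∣ {x = suc x} (outside ∷ p) x∉p = ∣p∪⁅x⁆∣≡1+∣p∣ p (x∉p ∘ there)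

∣p∪⁅x⁆∣≤1+∣p∣ : ∀ (p : Subset n) x → ∣ p ∪ ⁅ x ⁆ ∣ ≤ suc ∣ p ∣
∣p∪⁅x⁆∣≤1+∣p∣ p x with x ∈? p
... | no  x∉p = ≤-reflexive (∣p∪⁅x⁆∣≡1+∣p∣ p x∉p)
... | yes x∈p = ≤-trans (p⊆q⇒∣p∣≤∣q∣ p∪⁅x⁆⊆p) (n≤1+n _)
  where
    p∪⁅x⁆⊆p : ∀ {y} → y ∈ p ∪ ⁅ x ⁆ → y ∈ p
    p∪⁅x⁆⊆p y∈ = [ id , (λ y∈⁅x⁆ → subst (_∈ p) (sym (x∈⁅y⁆⇒x≡y x y∈⁅x⁆)) x∈p) ]′ (x∈p∪q⁻ p ⁅ x ⁆ y∈)

x∈p─q⇒x∉q : ∀ (p q : Subset n) → x ∈ p ─ q → x ∉ q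
x∈p─q⇒x∉q (_ ∷ p) (outside ∷ q) here      ()
x∈p─q⇒x∉q (_ ∷ p) (inside  ∷ q) ()        here
x∈p─q⇒x∉q (_ ∷ p) (_       ∷ q) (there h) (there h′) = x∈p─q⇒x∉q p q h h′

x∉p-x : x ∉ X - x
x∉p-x {x = x} {X = X} x∈X-x = x∈p─q⇒x∉q X ⁅ x ⁆ x∈X-x (x∈⁅x⁆ x)

p-x∪⁅x⁆≡p : x ∈ X → (X - x) ∪ ⁅ x ⁆ ≡ X
p-x∪⁅x⁆≡p {x = x} {X = X} x∈X = ⊆-antisym ⊆X X⊆
  where
    ⊆X : ∀ {y} → y ∈ (X - x) ∪ ⁅ x ⁆ → y ∈ X
    ⊆X y∈ = [ p─q⊆p X ⁅ x ⁆ , (λ y∈⁅x⁆ → subst (_∈ X) (sym (x∈⁅y⁆⇒x≡y x y∈⁅x⁆)) x∈X) ]′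
              (x∈p∪q⁻ (X - x) ⁅ x ⁆ y∈)
    X⊆ : ∀ {y} → y ∈ X → y ∈ (X - x) ∪ ⁅ x ⁆
    X⊆ {y} y∈X with y ≟ᶠ x
    ... | yes refl = x∈p∪q⁺ (inj₂ (x∈⁅x⁆ x))
    ... | no  y≢x  = x∈p∪q⁺ (inj₁ (x∈p∧x≢y⇒x∈p-y y∈X y≢x))

x∈p⇒1+∣p-x∣≡∣p∣ : x ∈ X → suc ∣ X - x ∣ ≡ ∣ X ∣
x∈p⇒1+∣p-x∣≡∣p∣ {x = x} {X = X} x∈X =
  trans (sym (∣p∪⁅x⁆∣≡1+∣p∣ (X - x) x∉p-x)) (cong ∣_∣ (p-x∪⁅x⁆≡p x∈X))

disjoint⁺ : (∀ {x} → x ∈ X → x ∉ Y) → Disjoint X Y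
disjoint⁺ {X = X} {Y = Y} X#Y = Empty-unique λ (_ , x∈X∩Y) → uncurry X#Y (x∈p∩q⁻ X Y x∈X∩Y)

disjoint⁻ : Disjoint X Y → x ∈ X → x ∉ Y
disjoint⁻ {x = x} X∩Y≡∅ x∈X x∈Y = ∉⊥ (subst (x ∈_) X∩Y≡∅ (x∈p∩q⁺ (x∈X , x∈Y)))

∈-elements : x ∈ˡ elements X ⇔ x ∈ X
∈-elements {x = x} {X = X} =
  mk⇔ (proj₂ ∘ ∈-filter⁻ (_∈? X) {xs = allFin _}) (∈-filter⁺ (_∈? X) (∈-allFin x))

below : ∀ m → ℕ → Subset m
below zero    _       = []
below (suc m) zero    = ∅ˢ
below (suc m) (suc ℓ) = inside ∷ below m ℓ

∈below⇒< : t ∈ below m ℓ → toℕ t < ℓ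
∈below⇒< {m = suc m} {ℓ = zero}  t∈∅        = contradiction t∈∅ ∉⊥
∈below⇒< {m = suc m} {ℓ = suc ℓ} here       = s≤s z≤n
∈below⇒< {m = suc m} {ℓ = suc ℓ} (there t∈) = s≤s (∈below⇒< t∈)

<⇒∈below : toℕ t < ℓ → t ∈ below m ℓ
<⇒∈below {t = zero}  {ℓ = suc ℓ} _         = here
<⇒∈below {t = suc t} {ℓ = suc ℓ} (s≤s t<ℓ) = there (<⇒∈below t<ℓ)

∣below∣≡⊓ : ∀ m ℓ → ∣ below m ℓ ∣ ≡ ℓ ⊓ m
∣below∣≡⊓ zero    ℓ       = sym (⊓-zeroʳ ℓ)
∣below∣≡⊓ (suc m) zero    = ∣⊥∣≡0 (suc m)
∣below∣≡⊓ (suc m) (suc ℓ) = cong suc (∣below∣≡⊓ m ℓ)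

bounded⇒∣p∣≤ : (∀ t → t ∈ X → toℕ t < i) → ∣ X ∣ ≤ i
bounded⇒∣p∣≤ {n} {i = i} X<i =
  ≤-trans (p⊆q⇒∣p∣≤∣q∣ (<⇒∈below ∘ X<i _))
          (≤-trans (≤-reflexive (∣below∣≡⊓ n i)) (m⊓n≤m i n))

Extension : Fin n → (Subset n → Set) → Subset n → Set
Extension s F X = ∃ λ Z → F Z × s ∉ Z × X ≡ Z ∪ ⁅ s ⁆

Represents-cong : F ≐ G → Represents k p L F → Represents k p L G
Represents-cong (F⊆G , G⊆F) (sound , complete) =
  (λ X X∈L → F⊆G (sound X X∈L)) , (λ X GX → complete X (G⊆F GX))

[]-represents : (∀ {X} → ¬ F X) → Represents k p [] F
[]-represents ¬F = (λ _ ()) , (λ _ FX → contradiction FX ¬F)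

++-represents : Represents k p L F → Represents k p L′ G → Represents k p (L ++ L′) (F ∪ᵘ G)
++-represents {k = k} {p = p} {L = L} {F = F} {L′ = L′} {G = G} (sound , complete) (sound′ , complete′) =
  (λ X X∈ → [ inj₁ ∘ sound X , inj₂ ∘ sound′ X ]′ (∈-++⁻ L X∈)) , complete″
  where
    complete″ : ∀ X → (F ∪ᵘ G) X → ∀ Y → Disjoint X Y → ∣ Y ∣ ≤ k ∸ p →
                ∃ λ X̂ → X̂ ∈ˡ L ++ L′ × Disjoint X̂ Y
    complete″ X (inj₁ FX) Y X#Y ∣Y∣ with complete X FX Y X#Y ∣Y∣
    ... | X̂ , X̂∈L , X̂#Y = X̂ , ∈-++⁺ˡ X̂∈L , X̂#Y
    complete″ X (inj₂ GX) Y X#Y ∣Y∣ with complete′ X GX Y X#Y ∣Y∣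
    ... | X̂ , X̂∈L′ , X̂#Y = X̂ , ∈-++⁺ʳ L X̂∈L′ , X̂#Y

Represents-trans : Represents k p L′ (_∈ˡ L) → Represents k p L F → Represents k p L′ F
Represents-trans {k = k} {p = p} {L′ = L′} {F = F} (sound′ , complete′) (sound , complete) =
  (λ X X∈L′ → sound X (sound′ X X∈L′)) , complete″
  where
    complete″ : ∀ X → F X → ∀ Y → Disjoint X Y → ∣ Y ∣ ≤ k ∸ p → ∃ λ X̂ → X̂ ∈ˡ L′ × Disjoint X̂ Y
    complete″ X FX Y X#Y ∣Y∣ with complete X FX Y X#Y ∣Y∣
    ... | X̂ , X̂∈L , X̂#Y = complete′ X̂ X̂∈L Y X̂#Y ∣Y∣

rep-represents : ∀ {rep} → IsRepAlg k rep → p ≤ k → (∀ {X} → F X → ∣ X ∣ ≡ p) →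
                 Represents k p L F → Represents k p (rep L) F
rep-represents {k = k} {p = p} {L = L} isRep p≤k size L-represents =
  Represents-trans {k = k} {p = p} (isRep p p≤k L λ X X∈L → size (proj₁ L-represents X X∈L)) L-represents

≤ᵇ-true : i ≤ j → (i ≤ᵇ j) ≡ true
≤ᵇ-true = Equivalence.to T-≡ ∘ ≤⇒≤ᵇ

≤ᵇ-false : ¬ i ≤ j → (i ≤ᵇ j) ≡ false
≤ᵇ-false {i} {j} i≰j with i ≤ᵇ j in eq
... | false = refl
... | true  = contradiction (≤ᵇ⇒≤ i j (Equivalence.from T-≡ eq)) i≰j

<1+∧≢⇒< : toℕ t < suc (toℕ u) → t ≢ u → toℕ t < toℕ u
<1+∧≢⇒< t<1+u t≢u = ≤∧≢⇒< (≤-pred t<1+u) (t≢u ∘ toℕ-injective)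

getSet-< : ∀ (S : Fin m → Subset n) (i<m : i < m) → getSet S i ≡ S (fromℕ< i<m)
getSet-< {m} {i = i} S i<m with i <? m
... | yes _   = refl
... | no  i≮m = contradiction i<m i≮m

module Correctness {n m : ℕ} (rep : List (Subset n) → List (Subset n)) (k : ℕ)
                   (S : Fin m → Subset n) (isRep : IsRepAlg k rep) where

  open PCAlg rep k S

  extend-represents : suc p ≤ k → Represents k p L F → Represents k (suc p) (extend s L) (Extension s F)
  extend-represents {p} {L} {F} {s} p<k (sound , complete) = sound′ , complete′
    where
      sound′ : ∀ X → X ∈ˡ extend s L → Extension s F X
      sound′ X X∈ with ∈-map∘filter⁻ (_∪ ⁅ s ⁆) (λ Z → ¬? (s ∈? Z)) X∈
      ... | Z , Z∈L , X≡Z∪s , s∉Z = Z , sound Z Z∈L , s∉Z , X≡Z∪s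

      complete′ : ∀ X → Extension s F X → ∀ Y → Disjoint X Y → ∣ Y ∣ ≤ k ∸ suc p →
                  ∃ λ X̂ → X̂ ∈ˡ extend s L × Disjoint X̂ Y
      complete′ _ (Z , FZ , s∉Z , refl) Y Z∪s#Y ∣Y∣≤ = lift (complete Z FZ (Y ∪ ⁅ s ⁆) Z#Y∪s ∣Y∪s∣≤)
        where
          Z#Y∪s : Disjoint Z (Y ∪ ⁅ s ⁆)
          Z#Y∪s = disjoint⁺ λ x∈Z x∈Y∪s →
            [ disjoint⁻ Z∪s#Y (x∈p∪q⁺ (inj₁ x∈Z))
            , (λ x∈⁅s⁆ → s∉Z (subst (_∈ Z) (x∈⁅y⁆⇒x≡y s x∈⁅s⁆) x∈Z)) ]′ (x∈p∪q⁻ Y ⁅ s ⁆ x∈Y∪s)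

          ∣Y∪s∣≤ : ∣ Y ∪ ⁅ s ⁆ ∣ ≤ k ∸ p
          ∣Y∪s∣≤ = ≤-trans (∣p∪⁅x⁆∣≤1+∣p∣ Y s) (≤-trans (s≤s ∣Y∣≤) (≤-reflexive (sym (+-∸-assoc 1 p<k))))

          -- Putting s into Y forces the representative Ẑ to avoid s.
          lift : (∃ λ Ẑ → Ẑ ∈ˡ L × Disjoint Ẑ (Y ∪ ⁅ s ⁆)) → ∃ λ X̂ → X̂ ∈ˡ extend s L × Disjoint X̂ Y
          lift (Ẑ , Ẑ∈L , Ẑ#Y∪s) =
            Ẑ ∪ ⁅ s ⁆ , ∈-map∘filter⁺ (_∪ ⁅ s ⁆) (λ Z → ¬? (s ∈? Z)) (Ẑ , Ẑ∈L , refl , s∉Ẑ) , Ẑ∪s#Y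
            where
              s∉Ẑ : s ∉ Ẑ
              s∉Ẑ s∈Ẑ = disjoint⁻ Ẑ#Y∪s s∈Ẑ (x∈p∪q⁺ (inj₂ (x∈⁅x⁆ s)))
              Ẑ∪s#Y : Disjoint (Ẑ ∪ ⁅ s ⁆) Y
              Ẑ∪s#Y = disjoint⁺ λ x∈Ẑ∪s x∈Y →
                [ (λ x∈Ẑ → disjoint⁻ Ẑ#Y∪s x∈Ẑ (x∈p∪q⁺ (inj₁ x∈Y)))
                , (λ x∈⁅s⁆ → disjoint⁻ Z∪s#Y (x∈p∪q⁺ (inj₂ x∈⁅s⁆)) x∈Y) ]′ (x∈p∪q⁻ Ẑ ⁅ s ⁆ x∈Ẑ∪s)

  module InnerLoop {ι : Set} (G : ι → Fin n → Set) where

    -- The j-sets contained in B ∪ G c for some c; in the inner loop B = {s₁,…,s_{r′}}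
    -- and G c = ⋃𝒮′.
    Within : (Fin n → Set) → ℕ → Subset n → Set
    Within B j X = ∣ X ∣ ≡ j × ∃ λ c → ∀ {x} → x ∈ X → B x ⊎ G c x

    Invariant : (Fin n → Set) → (ℕ → List (Subset n)) → Set
    Invariant B 𝒜 = ∀ j → j ≤ k → Represents k j (𝒜 j) (Within B j)

    Within-mono : ∀ {B B′} → B ⊆ B′ → Within B j ⊆ Within B′ j
    Within-mono B⊆B′ (size , c , cover) = size , c , λ x∈X → ⊎-map₁ B⊆B′ (cover x∈X)

    Within-zero : ∀ {B B′} → Within B 0 ⊆ Within B′ 0
    Within-zero (size , c , cover) = size , c , λ x∈X → contradiction (x∈p⇒0<∣p∣ x∈X) (<-irrefl (sym size))

    Invariant-cong : ∀ {B B′ 𝒜} → B ≐ B′ → Invariant B 𝒜 → Invariant B′ 𝒜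
    Invariant-cong (B⊆B′ , B′⊆B) inv j j≤k =
      Represents-cong {k = k} {p = j} (Within-mono B⊆B′ , Within-mono B′⊆B) (inv j j≤k)

    Within-size : ∀ {B} → Within B j X → ∣ X ∣ ≡ j
    Within-size = proj₁

    Within-shrink : ∀ {B} → (∀ {x} → x ∈ Y → x ∈ X) → ∣ Y ∣ ≡ i → Within B j X → Within B i Y
    Within-shrink Y⊆X size (_ , c , cover) = size , c , cover ∘ Y⊆X

    module _ {B : Fin n → Set} where

      Within-avoid : s ∉ X → Within (｛ s ｝ ∪ᵘ B) j X → Within B j X
      Within-avoid {s} {X} s∉X (size , c , cover) = size , c , cover′
        where
          cover′ : ∀ {x} → x ∈ X → B x ⊎ G c x
          cover′ x∈X with cover x∈X
          ... | inj₁ (inj₁ refl) = contradiction x∈X s∉X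
          ... | inj₁ (inj₂ Bx)   = inj₁ Bx
          ... | inj₂ Gcx         = inj₂ Gcx

      Within-insert : s ∉ Z → Within B j Z → Within (｛ s ｝ ∪ᵘ B) (suc j) (Z ∪ ⁅ s ⁆)
      Within-insert {s} {Z} s∉Z (size , c , cover) =
        trans (∣p∪⁅x⁆∣≡1+∣p∣ Z s∉Z) (cong suc size) , c , cover′
        where
          cover′ : ∀ {x} → x ∈ Z ∪ ⁅ s ⁆ → (｛ s ｝ ∪ᵘ B) x ⊎ G c x
          cover′ x∈Z∪s with x∈p∪q⁻ Z ⁅ s ⁆ x∈Z∪s
          ... | inj₁ x∈Z   = ⊎-map₁ inj₂ (cover x∈Z)
          ... | inj₂ x∈⁅s⁆ = inj₁ (inj₁ (sym (x∈⁅y⁆⇒x≡y s x∈⁅s⁆)))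

      Within-split : (Within B (suc j) ∪ᵘ Extension s (Within B j)) ≐ Within (｛ s ｝ ∪ᵘ B) (suc j)
      Within-split {j} {s} = [ Within-mono inj₂ , insert ]′ , split
        where
          insert : Extension s (Within B j) ⊆ Within (｛ s ｝ ∪ᵘ B) (suc j)
          insert (_ , W , s∉Z , refl) = Within-insert s∉Z W

          split : Within (｛ s ｝ ∪ᵘ B) (suc j) ⊆ (Within B (suc j) ∪ᵘ Extension s (Within B j))
          split {X} W with s ∈? X
          ... | no  s∉X = inj₁ (Within-avoid s∉X W)
          ... | yes s∈X = inj₂ (X - s , Within-avoid x∉p-x W-s , x∉p-x , sym (p-x∪⁅x⁆≡p s∈X))
            where
              W-s : Within (｛ s ｝ ∪ᵘ B) j (X - s)
              W-s = Within-shrink (p─q⊆p X ⁅ s ⁆) (suc-injective (trans (x∈p⇒1+∣p-x∣≡∣p∣ s∈X) (Within-size W))) W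

      ∅-represents : ι → Represents k 0 [ ∅ˢ ] (Within B 0)
      ∅-represents c =
        (λ { _ (here refl) → ∣⊥∣≡0 n , c , λ x∈∅ → contradiction x∈∅ ∉⊥ })
        , λ _ _ _ _ _ → ∅ˢ , here refl , disjoint⁺ λ x∈∅ → contradiction x∈∅ ∉⊥

      stepA-invariant : ∀ {𝒜} → Invariant B 𝒜 → Invariant (｛ s ｝ ∪ᵘ B) (stepA 𝒜 s)
      stepA-invariant inv zero z≤k =
        rep-represents isRep z≤k Within-size (Represents-cong {k = k} {p = 0} (Within-zero , Within-zero) (inv 0 z≤k))
      stepA-invariant inv (suc j) j<k =
        rep-represents isRep j<k Within-size
          (Represents-cong {k = k} {p = suc j} Within-split
            (++-represents {k = k} {p = suc j} (inv (suc j) j<k) (extend-represents j<k (inv j (<⇒≤ j<k)))))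

    foldl-invariant : ∀ {B 𝒜} xs → Invariant B 𝒜 → Invariant ((_∈ˡ xs) ∪ᵘ B) (foldl stepA 𝒜 xs)
    foldl-invariant {B} [] inv = Invariant-cong (inj₂ , [ (λ ()) , id ]′) inv
    foldl-invariant {B} (y ∷ xs) inv =
      Invariant-cong (shift , unshift) (foldl-invariant xs (stepA-invariant inv))
      where
        shift : ((_∈ˡ xs) ∪ᵘ (｛ y ｝ ∪ᵘ B)) ⊆ ((_∈ˡ y ∷ xs) ∪ᵘ B)
        shift (inj₁ x∈xs)         = inj₁ (there x∈xs)
        shift (inj₂ (inj₁ refl))  = inj₁ (here refl)
        shift (inj₂ (inj₂ Bx))    = inj₂ Bx
        unshift : ((_∈ˡ y ∷ xs) ∪ᵘ B) ⊆ ((_∈ˡ xs) ∪ᵘ (｛ y ｝ ∪ᵘ B))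
        unshift (inj₁ (here refl))   = inj₂ (inj₁ refl)
        unshift (inj₁ (there x∈xs))  = inj₁ x∈xs
        unshift (inj₂ Bx)            = inj₂ (inj₂ Bx)

  Selection : ℕ → ℕ → Set
  Selection i ℓ = Σ (Subset m) λ I → (∀ t → t ∈ I → toℕ t < i) × ∣ I ∣ ≡ ℓ

  ⋃ : Selection i ℓ → Fin n → Set
  ⋃ (I , _) x = ∃ λ t → t ∈ I × x ∈ S t

  module Row (i ℓ : ℕ) = InnerLoop (⋃ {i = i} {ℓ = ℓ})

  first-selection : ℓ ≤ i → i ≤ m → Selection i ℓ
  first-selection {ℓ} ℓ≤i i≤m =
    below m ℓ , (λ t t∈ → <-≤-trans (∈below⇒< t∈) ℓ≤i) , trans (∣below∣≡⊓ m ℓ) (m≤n⇒m⊓n≡m (≤-trans ℓ≤i i≤m))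

  Sol-size : Sol S i j ℓ X → ∣ X ∣ ≡ j
  Sol-size (_ , _ , _ , _ , size) = size

  Sol-bounds : Sol S i (suc j) ℓ X → 0 < ℓ × ℓ ≤ i
  Sol-bounds (I , I<i , refl , cover , size) with ∣p∣≡1+n⇒Nonempty size
  ... | x , x∈X with cover x x∈X
  ... | _ , t∈I , _ = x∈p⇒0<∣p∣ t∈I , bounded⇒∣p∣≤ I<i

  Sol≐Within : Sol S i j ℓ ≐ Row.Within i ℓ ∅ j
  Sol≐Within =
    (λ (I , I<i , ∣I∣ , cover , size) → size , (I , I<i , ∣I∣) , λ x∈X → inj₂ (cover _ x∈X)) ,
    (λ (size , (I , I<i , ∣I∣) , cover) → I , I<i , ∣I∣ , (λ _ x∈X → [ (λ ()) , id ]′ (cover x∈X)) , size)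

  Sol-suc⁺ : {t₀ : Fin m} → toℕ t₀ ≡ i →
             (Sol S i j (suc ℓ) ∪ᵘ Row.Within i ℓ (_∈ S t₀) j) ⊆ Sol S (suc i) j (suc ℓ)
  Sol-suc⁺ _ (inj₁ (I , I<i , rest)) = I , (λ t t∈I → m<n⇒m<1+n (I<i t t∈I)) , rest
  Sol-suc⁺ {t₀ = t₀} refl {X} (inj₂ (size , (I , I<t₀ , ∣I∣≡ℓ) , cover)) =
    I ∪ ⁅ t₀ ⁆ , bound , trans (∣p∪⁅x⁆∣≡1+∣p∣ I t₀∉I) (cong suc ∣I∣≡ℓ) , cover′ , size
    where
      t₀∉I : t₀ ∉ I
      t₀∉I t₀∈I = <-irrefl refl (I<t₀ t₀ t₀∈I)
      bound : ∀ t → t ∈ I ∪ ⁅ t₀ ⁆ → toℕ t < suc (toℕ t₀)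
      bound t t∈ = [ m<n⇒m<1+n ∘ I<t₀ t
                   , (λ t∈⁅t₀⁆ → s≤s (≤-reflexive (cong toℕ (x∈⁅y⁆⇒x≡y t₀ t∈⁅t₀⁆)))) ]′ (x∈p∪q⁻ I ⁅ t₀ ⁆ t∈)
      cover′ : ∀ x → x ∈ X → ∃ λ t → t ∈ I ∪ ⁅ t₀ ⁆ × x ∈ S t
      cover′ x x∈X with cover x∈X
      ... | inj₁ x∈St₀           = t₀ , x∈p∪q⁺ (inj₂ (x∈⁅x⁆ t₀)) , x∈St₀
      ... | inj₂ (t , t∈I , x∈St) = t , x∈p∪q⁺ (inj₁ t∈I) , x∈St

  Sol-suc⁻ : {t₀ : Fin m} → toℕ t₀ ≡ i →
             Sol S (suc i) j (suc ℓ) ⊆ (Sol S i j (suc ℓ) ∪ᵘ Row.Within i ℓ (_∈ S t₀) j)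
  Sol-suc⁻ {ℓ = ℓ} {t₀ = t₀} refl {X} (I , I≤t₀ , ∣I∣ , cover , size) with t₀ ∈? I
  ... | no t₀∉I = inj₁ (I , (λ t t∈I → <1+∧≢⇒< (I≤t₀ t t∈I) λ { refl → t₀∉I t∈I }) , ∣I∣ , cover , size)
  ... | yes t₀∈I = inj₂ (size , (I - t₀ , bound , ∣I-t₀∣) , cover′)
    where
      ∣I-t₀∣ : ∣ I - t₀ ∣ ≡ ℓ
      ∣I-t₀∣ = suc-injective (trans (x∈p⇒1+∣p-x∣≡∣p∣ t₀∈I) ∣I∣)
      bound : ∀ t → t ∈ I - t₀ → toℕ t < toℕ t₀
      bound t t∈ = <1+∧≢⇒< (I≤t₀ t (p─q⊆p I ⁅ t₀ ⁆ t∈)) λ { refl → x∉p-x t∈ }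
      cover′ : ∀ {x} → x ∈ X → x ∈ S t₀ ⊎ ⋃ (I - t₀ , bound , ∣I-t₀∣) x
      cover′ x∈X with cover _ x∈X
      ... | t , t∈I , x∈St with t ≟ᶠ t₀
      ... | yes refl = inj₁ x∈St
      ... | no  t≢t₀ = inj₂ (t , x∈p∧x≢y⇒x∈p-y t∈I t≢t₀ , x∈St)

  Correct : ℕ → Set
  Correct i = ∀ j ℓ → 1 ≤ j → j ≤ k → ℓ ≤ k → Represents k j (M i j ℓ) (Sol S i j ℓ)

  Afinal-invariant : ℓ ≤ i → (i<m : i < m) → ℓ ≤ k → Correct i →
                     Row.Invariant i ℓ (_∈ S (fromℕ< i<m)) (Afinal i ℓ)
  Afinal-invariant {ℓ} {i} ℓ≤i i<m ℓ≤k correct =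
    Row.Invariant-cong i ℓ (elements⊆ , ⊆elements)
      (Row.foldl-invariant i ℓ (elements (getSet S i))
        λ { zero    _   → Row.∅-represents i ℓ (first-selection ℓ≤i (<⇒≤ i<m))
          ; (suc j) j<k → Represents-cong {k = k} {p = suc j} Sol≐Within (correct (suc j) ℓ (s≤s z≤n) j<k ℓ≤k) })
    where
      elements⊆ : ((_∈ˡ elements (getSet S i)) ∪ᵘ ∅) ⊆ (_∈ S (fromℕ< i<m))
      elements⊆ (inj₁ x∈) = subst (_ ∈_) (getSet-< S i<m) (Equivalence.to ∈-elements x∈)
      ⊆elements : (_∈ S (fromℕ< i<m)) ⊆ ((_∈ˡ elements (getSet S i)) ∪ᵘ ∅)
      ⊆elements x∈ = inj₁ (Equivalence.from ∈-elements (subst (_ ∈_) (sym (getSet-< S i<m)) x∈))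

  step-represents : suc ℓ ≤ suc i → suc i ≤ m → suc j ≤ k → suc ℓ ≤ k → Correct i →
    Represents k (suc j) (rep (M i (suc j) (suc ℓ) ++ Afinal i ℓ (suc j))) (Sol S (suc i) (suc j) (suc ℓ))
  step-represents {j = j} ℓ<1+i i<m j<k ℓ<k correct =
    rep-represents isRep j<k Sol-size
      (Represents-cong {k = k} {p = suc j} (Sol-suc⁺ (toℕ-fromℕ< i<m) , Sol-suc⁻ (toℕ-fromℕ< i<m))
        (++-represents {k = k} {p = suc j} (correct _ _ (s≤s z≤n) j<k ℓ<k)
          (Afinal-invariant (≤-pred ℓ<1+i) i<m (<⇒≤ ℓ<k) correct _ j<k)))

  M-step : suc j ≤ k → suc ℓ ≤ suc i → suc ℓ ≤ k →
           M (suc i) (suc j) (suc ℓ) ≡ rep (M i (suc j) (suc ℓ) ++ Afinal i ℓ (suc j))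
  M-step j<k ℓ<1+i ℓ<k rewrite ≤ᵇ-true j<k | ≤ᵇ-true (⊓-glb ℓ<1+i ℓ<k) = refl

  M-outside : suc j ≤ k → ¬ suc ℓ ≤ suc i → M (suc i) (suc j) (suc ℓ) ≡ []
  M-outside {i = i} j<k ℓ≮1+i rewrite ≤ᵇ-true j<k | ≤ᵇ-false (ℓ≮1+i ∘ m≤n⊓o⇒m≤n (suc i) k) = refl

  correct : i ≤ m → Correct i
  correct {zero}  _ (suc j) ℓ _ _ _ = []-represents {k = k} {p = suc j} (n≮0 ∘ uncurry <-≤-trans ∘ Sol-bounds)
  correct {suc i} _ (suc j) zero _ _ _ = []-represents {k = k} {p = suc j} (n≮0 ∘ proj₁ ∘ Sol-bounds)
  correct {suc i} i<m (suc j) (suc ℓ) _ j<k ℓ<k with suc ℓ ≤? suc i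
  ... | yes ℓ<1+i rewrite M-step j<k ℓ<1+i ℓ<k = step-represents ℓ<1+i i<m j<k ℓ<k (correct (<⇒≤ i<m))
  ... | no  ℓ≮1+i rewrite M-outside j<k ℓ≮1+i = []-represents {k = k} {p = suc j} (ℓ≮1+i ∘ proj₂ ∘ Sol-bounds)

lemma2 : (n m k : ℕ) (S : Fin m → Subset n) →
    (∀ t t′ → S t ≡ S t′ → t ≡ t′) →
    (∀ t → ∣ S t ∣ < k) →
    (rep : List (Subset n) → List (Subset n)) → IsRepAlg k rep →
    ∀ i j ℓ → i ≤ m → 1 ≤ j → j ≤ k → ℓ ≤ k →
    Represents k j (PCAlg.M rep k S i j ℓ) (Sol S i j ℓ)
-- Sol quantifies over index sets, so neither injectivity of S nor the size bound is needed.
lemma2 n m k S _ _ rep isRep i j ℓ i≤m = Correctness.correct rep k S isRep i≤m j ℓ
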